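{- If $G$ and $H$ are Left dead ends with $\operatorname{flex}(G)\leq1$ and $\mathcal{T}(G)\subseteq\mathcal{T}(H)$, then $G\geq H$.
   Context: All games are short partizan combinatorial game forms; $G+H$ is the disjunctive sum; $\cong$ denotes identity of game forms. Play is misère (a player unable to move wins). Misère outcome classes are ordered $\mathscr L>\mathscr P>\mathscr R$ and $\mathscr L>\mathscr N>\mathscr R$; $G\geq H$ means that for every game $X$ the misère outcome of $G+X$ is $\geq$ that of $H+X$. A Left dead end is a game no subposition of which (including itself) has a Left option; its options are its Right options. A run of length $k$ of $G$ is a sequence $(G_0,\dots,G_k)$ with $G_0\cong G$ and $G_{i+1}$ an option of $G_i$; it is terminal if $G_k\cong0=\{\cdot\mid\cdot\}$; $\mathcal{T}(G)$ is the set of lengths of terminal runs of $G$. Let $\overline{0}=0$ and $\overline{n}=\{\cdot\mid\overline{n-1}\}$ for $n\geq1$; a Left dead end is an integer if it is isomorphic to some $\overline{n}$. The flexibility is defined recursively by $\operatorname{flex}(G)=0$ if $G$ is an integer, and otherwise $\operatorname{flex}(G)=1+\max_{G'}\operatorname{flex}(G')$ over options $G'$ of $G$. -}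

module Defs where

open import Data.Nat using (ℕ; zero; suc; _≤_)
open import Data.Bool using (Bool; true; false; _∧_; _∨_; not)
open import Data.List using (List; []; _∷_; _++_)
open import Data.List.Relation.Unary.All using (All)
open import Data.List.Relation.Unary.Any using (Any)
open import Data.Product using (Σ; _×_; ∃)
open import Relation.Binary.PropositionalEquality using (_≡_)
open import Relation.Nullary using (¬_)

data Game : Set where
  ⟨_∣_⟩ : List Game → List Game → Game

lefts : Game → List Game
lefts ⟨ l ∣ r ⟩ = l

rights : Game → List Game
rights ⟨ l ∣ r ⟩ = r

options : Game → List Game
options ⟨ l ∣ r ⟩ = l ++ r

zeroG : Game
zeroG = ⟨ [] ∣ [] ⟩

-- Options are sets, so order and
-- repetitions in the lists are irrelevant.
data _≅_ : Game → Game → Set where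
  iso : ∀ {gl gr hl hr} →
        All (λ a → Any (a ≅_) hl) gl →
        All (λ b → Any (b ≅_) gl) hl →
        All (λ a → Any (a ≅_) hr) gr →
        All (λ b → Any (b ≅_) gr) hr →
        ⟨ gl ∣ gr ⟩ ≅ ⟨ hl ∣ hr ⟩

mutual
  _+G_ : Game → Game → Game
  G@(⟨ gl ∣ gr ⟩) +G H@(⟨ hl ∣ hr ⟩) =
    ⟨ sumL gl H ++ sumR G hl ∣ sumL gr H ++ sumR G hr ⟩

  sumL : List Game → Game → List Game
  sumL []       H = []
  sumL (g ∷ gs) H = (g +G H) ∷ sumL gs H

  sumR : Game → List Game → List Game
  sumR G []       = []
  sumR G (h ∷ hs) = (G +G h) ∷ sumR G hs

infixl 6 _+G_

-- Misère play (a player unable to move wins).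
-- leftFirst G  : Left, moving first in G, wins.
-- leftSecond G : Left wins when Right moves first in G.
mutual
  leftFirst : Game → Bool
  leftFirst ⟨ [] ∣ r ⟩      = true
  leftFirst ⟨ l ∷ ls ∣ r ⟩ = anyLeftSecond (l ∷ ls)

  leftSecond : Game → Bool
  leftSecond ⟨ l ∣ [] ⟩     = false
  leftSecond ⟨ l ∣ r ∷ rs ⟩ = allLeftFirst (r ∷ rs)

  anyLeftSecond : List Game → Bool
  anyLeftSecond []       = false
  anyLeftSecond (g ∷ gs) = leftSecond g ∨ anyLeftSecond gs

  allLeftFirst : List Game → Bool
  allLeftFirst []       = true
  allLeftFirst (g ∷ gs) = leftFirst g ∧ allLeftFirst gs

data Outcome : Set where
  𝓛 𝓝 𝓟 𝓡 : Outcome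

outcomeOf : Bool → Bool → Outcome
outcomeOf true  true  = 𝓛
outcomeOf true  false = 𝓝
outcomeOf false true  = 𝓟
outcomeOf false false = 𝓡

outcome : Game → Outcome
outcome G = outcomeOf (leftFirst G) (leftSecond G)

data _≤ₒ_ : Outcome → Outcome → Set where
  refl≤ : ∀ {o} → o ≤ₒ o
  R≤    : ∀ {o} → 𝓡 ≤ₒ o
  ≤L    : ∀ {o} → o ≤ₒ 𝓛

_≥G_ : Game → Game → Set
G ≥G H = (X : Game) → outcome (H +G X) ≤ₒ outcome (G +G X)

data LeftDeadEnd : Game → Set where
  dead : ∀ {r} → All LeftDeadEnd r → LeftDeadEnd ⟨ [] ∣ r ⟩

-- Terminal runs: TerminalRun G k holds iff there is a run
-- (G₀,…,G_k) with G₀ ≅ G (we start at G itself), G_{i+1} an option of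
-- G_i, and G_k ≅ 0.  𝒯(G) = { k | TerminalRun G k }.
data TerminalRun : Game → ℕ → Set where
  stop : ∀ {G} → G ≅ zeroG → TerminalRun G zero
  step : ∀ {G k} → Any (λ G' → TerminalRun G' k) (options G) →
         TerminalRun G (suc k)

bar : ℕ → Game
bar zero    = zeroG
bar (suc n) = ⟨ [] ∣ bar n ∷ [] ⟩

IsInteger : Game → Set
IsInteger G = LeftDeadEnd G × ∃ λ n → G ≅ bar n

-- Flexibility, as the graph of the recursive definition:
-- Flex G n  means  flex(G) = n, where flex(G) = 0 if G is an integer,
-- and otherwise flex(G) = 1 + max of flex(G') over the options G'.
data Flex : Game → ℕ → Set where
  flex-int : ∀ {G} → IsInteger G → Flex G zero
  flex-max : ∀ {G m} → ¬ IsInteger G →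
             All (λ G' → ∃ λ k → Flex G' k × k ≤ m) (options G) →
             Any (λ G' → Flex G' m) (options G) →
             Flex G (suc m)

{-# OPTIONS --safe #-}

-- If neither G nor H offers Left a move, and every Right option of G is
-- ≥ some Right option of H, then G ≥ H: Left's win in H + X transfers to
-- G + X move for move, a Right move to g + X being met as if it were a
-- move to h + X with g ≥ h.  By induction on n this makes the integer n̄
-- dominate every Left dead end with a terminal run of length n.  If
-- flex(G) ≤ 1, then G is an integer, or every Right option of G is an
-- integer ā; then a + 1 ∈ 𝒯(G) ⊆ 𝒯(H), so some Right option of H has a
-- terminal run of length a and is dominated by ā.

module Submission where

open import Defs
open import Data.Nat using (ℕ; _≤_; zero; suc; z≤n; s≤s)
open import Data.Product as Product using (_×_; ∃; _,_; proj₁; proj₂; uncurry)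
import Data.Sum as Sum
open import Data.Bool using (true; false; T)
open import Data.Bool.Properties using (T-∧; T-∨)
open import Data.Unit using (tt)
open import Data.Empty using (⊥-elim)
open import Data.List using ([]; _∷_; _++_)
open import Data.List.Relation.Unary.All as All using (All; []; _∷_)
open import Data.List.Relation.Unary.All.Properties using (++⁺; ++⁻)
open import Data.List.Relation.Unary.Any as Any using (Any; here; there)
open import Data.List.Relation.Unary.Any.Properties using (singleton⁻)
open import Data.List.Membership.Propositional using (_∈_; lose)
open import Function using (_∘_; _⇔_; mk⇔; Equivalence)
open import Relation.Binary.PropositionalEquality using (_≡_; refl)

open Equivalence using (to; from)

Game-ind : (P : Game → Set) → (∀ {l r} → All P l → All P r → P ⟨ l ∣ r ⟩) → ∀ G → P G
Game-ind P ih ⟨ l ∣ r ⟩ = ih (all l) (all r)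
  where
  all : ∀ gs → All P gs
  all []       = []
  all (g ∷ gs) = Game-ind P ih g ∷ all gs

Any-sumR-mono : ∀ {P : Game → Set} {G H} {xs} → All (λ x → P (H +G x) → P (G +G x)) xs →
                Any P (sumR H xs) → Any P (sumR G xs)
Any-sumR-mono (f ∷ _)  (here w)  = here (f w)
Any-sumR-mono (_ ∷ fs) (there w) = there (Any-sumR-mono fs w)

All-sumR-mono : ∀ {P : Game → Set} {G H} {xs} → All (λ x → P (H +G x) → P (G +G x)) xs →
                All P (sumR H xs) → All P (sumR G xs)
All-sumR-mono []       []       = []
All-sumR-mono (f ∷ fs) (w ∷ ws) = f w ∷ All-sumR-mono fs ws

anyLeftSecond⇔ : ∀ gs → T (anyLeftSecond gs) ⇔ Any (T ∘ leftSecond) gs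
anyLeftSecond⇔ []       = mk⇔ (λ ()) (λ ())
anyLeftSecond⇔ (g ∷ gs) = mk⇔
  (Any.fromSum ∘ Sum.map₂ (to (anyLeftSecond⇔ gs)) ∘ to T-∨)
  (from T-∨ ∘ Sum.map₂ (from (anyLeftSecond⇔ gs)) ∘ Any.toSum)

allLeftFirst⇔ : ∀ gs → T (allLeftFirst gs) ⇔ All (T ∘ leftFirst) gs
allLeftFirst⇔ []       = mk⇔ (λ _ → []) (λ _ → tt)
allLeftFirst⇔ (g ∷ gs) = mk⇔
  (uncurry _∷_ ∘ Product.map₂ (to (allLeftFirst⇔ gs)) ∘ to T-∧)
  (from T-∧ ∘ Product.map₂ (from (allLeftFirst⇔ gs)) ∘ All.uncons)

leftSecond⇒allLeftFirst : ∀ {l} r → T (leftSecond ⟨ l ∣ r ⟩) → All (T ∘ leftFirst) r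
leftSecond⇒allLeftFirst (r ∷ rs) w = to (allLeftFirst⇔ (r ∷ rs)) w

outcomeOf-mono : ∀ {a b c d} → (T a → T c) → (T b → T d) → outcomeOf a b ≤ₒ outcomeOf c d
outcomeOf-mono {false} {false}                _ _ = R≤
outcomeOf-mono {c = true}     {d = true}      _ _ = ≤L
outcomeOf-mono {true}         {c = false}     f _ = ⊥-elim (f tt)
outcomeOf-mono {b = true}     {d = false}     _ g = ⊥-elim (g tt)
outcomeOf-mono {true} {false} {true}  {false} _ _ = refl≤
outcomeOf-mono {false} {true} {false} {true}  _ _ = refl≤

≤ₒ⇒leftFirst : ∀ {a b c d} → outcomeOf a b ≤ₒ outcomeOf c d → T a → T c
≤ₒ⇒leftFirst {true} {c = true}               _  _ = tt
≤ₒ⇒leftFirst {true} {true}  {false} {true}   () _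
≤ₒ⇒leftFirst {true} {true}  {false} {false}  () _
≤ₒ⇒leftFirst {true} {false} {false} {true}   () _
≤ₒ⇒leftFirst {true} {false} {false} {false}  () _

≥G⇒leftFirst : ∀ {G H} → G ≥G H → ∀ X → T (leftFirst (H +G X)) → T (leftFirst (G +G X))
≥G⇒leftFirst {G} {H} G≥H X =
  ≤ₒ⇒leftFirst {leftFirst (H +G X)} {leftSecond (H +G X)}
               {leftFirst (G +G X)} {leftSecond (G +G X)} (G≥H X)

≥some⇒leftFirst : ∀ {g hr} X → Any (g ≥G_) hr →
                  All (T ∘ leftFirst) (sumL hr X) → T (leftFirst (g +G X))
≥some⇒leftFirst {g} {h ∷ _} X (here g≥h)  (w ∷ _)  = ≥G⇒leftFirst {g} {h} g≥h X w
≥some⇒leftFirst {g}         X (there g≥h) (_ ∷ ws) = ≥some⇒leftFirst {g} X g≥h ws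

All-sumL-dominated : ∀ {gr hr} X → All (λ g → Any (g ≥G_) hr) gr →
                     All (T ∘ leftFirst) (sumL hr X) → All (T ∘ leftFirst) (sumL gr X)
All-sumL-dominated         X []       _  = []
All-sumL-dominated {g ∷ _} X (d ∷ ds) ws =
  ≥some⇒leftFirst {g} X d ws ∷ All-sumL-dominated X ds ws

≥G-fromRightOptions : ∀ {g gs hr} → All (λ g′ → Any (g′ ≥G_) hr) (g ∷ gs) →
                      ⟨ [] ∣ g ∷ gs ⟩ ≥G ⟨ [] ∣ hr ⟩
≥G-fromRightOptions {g} {gs} {hr} dominated X =
  outcomeOf-mono (proj₁ (improves X)) (proj₂ (improves X))
  where
  G H : Game
  G = ⟨ [] ∣ g ∷ gs ⟩
  H = ⟨ [] ∣ hr ⟩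

  Improves : Game → Set
  Improves X = (T (leftFirst (H +G X)) → T (leftFirst (G +G X)))
             × (T (leftSecond (H +G X)) → T (leftSecond (G +G X)))

  leftFirst-improves : ∀ {xl xr} → All Improves xl →
                       T (leftFirst (H +G ⟨ xl ∣ xr ⟩)) → T (leftFirst (G +G ⟨ xl ∣ xr ⟩))
  leftFirst-improves {[]}     _  _ = tt
  leftFirst-improves {x ∷ xs} ih w =
    from (anyLeftSecond⇔ (sumR G (x ∷ xs)))
         (Any-sumR-mono (All.map proj₂ ih) (to (anyLeftSecond⇔ (sumR H (x ∷ xs))) w))

  leftSecond-improves : ∀ {xl xr} → All Improves xr →
                        T (leftSecond (H +G ⟨ xl ∣ xr ⟩)) → T (leftSecond (G +G ⟨ xl ∣ xr ⟩))
  leftSecond-improves {xl} {xr} ih w =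
    let X = ⟨ xl ∣ xr ⟩
        (winsHr , winsXr) =
          ++⁻ (sumL hr X) (leftSecond⇒allLeftFirst (sumL hr X ++ sumR H xr) w)
    in from (allLeftFirst⇔ (sumL (g ∷ gs) X ++ sumR G xr))
            (++⁺ (All-sumL-dominated X dominated winsHr)
                 (All-sumR-mono (All.map proj₁ ih) winsXr))

  improves : ∀ X → Improves X
  improves = Game-ind Improves (λ ihl ihr → leftFirst-improves ihl , leftSecond-improves ihr)

≅zero⇒≡zero : ∀ {G} → G ≅ zeroG → G ≡ zeroG
≅zero⇒≡zero {⟨ []    ∣ []    ⟩} _                    = refl
≅zero⇒≡zero {⟨ _ ∷ _ ∣ _     ⟩} (iso (() ∷ _) _ _ _)
≅zero⇒≡zero {⟨ []    ∣ _ ∷ _ ⟩} (iso _ _ (() ∷ _) _)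

≅bar⇒TerminalRun : ∀ n {G} → G ≅ bar n → TerminalRun G n
≅bar⇒TerminalRun zero    G≅0 = stop G≅0
≅bar⇒TerminalRun (suc n) {⟨ _ ∷ _ ∣ _     ⟩} (iso (() ∷ _) _ _ _)
≅bar⇒TerminalRun (suc n) {⟨ []    ∣ []    ⟩} (iso _ _ _ (() ∷ _))
≅bar⇒TerminalRun (suc n) {⟨ []    ∣ _ ∷ _ ⟩} (iso _ _ (here g≅n ∷ _) _) =
  step (here (≅bar⇒TerminalRun n g≅n))

mutual
  integer-≥G : ∀ n {G H} → G ≅ bar n → LeftDeadEnd H → TerminalRun H n → G ≥G H
  integer-≥G zero G≅0 _ (stop H≅0) rewrite ≅zero⇒≡zero G≅0 | ≅zero⇒≡zero H≅0 = λ _ → refl≤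
  integer-≥G (suc n) {⟨ _ ∷ _ ∣ _     ⟩} (iso (() ∷ _) _ _ _)
  integer-≥G (suc n) {⟨ []    ∣ []    ⟩} (iso _ _ _ (() ∷ _))
  integer-≥G (suc n) {⟨ []    ∣ _ ∷ _ ⟩} (iso _ _ options≅n _) (dead ldh) run =
    ≥G-fromRightOptions
      (All.map (λ g≅n → integer-≥G-someRightOption n (singleton⁻ g≅n) ldh run) options≅n)

  integer-≥G-someRightOption : ∀ n {g hr} → g ≅ bar n → All LeftDeadEnd hr →
                               TerminalRun ⟨ [] ∣ hr ⟩ (suc n) → Any (g ≥G_) hr
  integer-≥G-someRightOption n g≅n (ld ∷ _)  (step (here run))   =
    here (integer-≥G n g≅n ld run)
  integer-≥G-someRightOption n g≅n (_ ∷ ldh) (step (there runs)) =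
    there (integer-≥G-someRightOption n g≅n ldh (step runs))

integerRightOptions-≥G : ∀ {gr H} → All (λ g → ∃ λ n → g ≅ bar n) gr → LeftDeadEnd H →
                         (∀ k → TerminalRun ⟨ [] ∣ gr ⟩ k → TerminalRun H k) → ⟨ [] ∣ gr ⟩ ≥G H
integerRightOptions-≥G {[]} _ ldH runs = integer-≥G zero 0≅0 ldH (runs zero (stop 0≅0))
  where
  0≅0 : zeroG ≅ zeroG
  0≅0 = iso [] [] [] []
integerRightOptions-≥G {g ∷ gs} {⟨ [] ∣ hr ⟩} integers (dead ldh) runs =
  ≥G-fromRightOptions (All.tabulate dominated)
  where
  dominated : ∀ {g′} → g′ ∈ g ∷ gs → Any (g′ ≥G_) hr
  dominated g′∈gr =
    let (n , g′≅n) = All.lookup integers g′∈gr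
        G-run = step (lose g′∈gr (≅bar⇒TerminalRun n g′≅n))
    in integer-≥G-someRightOption n g′≅n ldh (runs (suc n) G-run)

flex≤0⇒integer : ∀ {G} → (∃ λ k → Flex G k × k ≤ 0) → ∃ λ n → G ≅ bar n
flex≤0⇒integer (_ , flex-int (_ , integer) , z≤n) = integer

mainTheorem10 : (G H : Game) → LeftDeadEnd G → LeftDeadEnd H →
                (∃ λ n → Flex G n × n ≤ 1) →
                ((k : ℕ) → TerminalRun G k → TerminalRun H k) →
                G ≥G H
mainTheorem10 _ _ _ ldH (_ , flex-int (_ , n , G≅n) , _) runs =
  integer-≥G n G≅n ldH (runs n (≅bar⇒TerminalRun n G≅n))
mainTheorem10 ⟨ [] ∣ _ ⟩ H (dead _) ldH (_ , flex-max {m = zero} _ optionsFlex≤0 _ , _) runs =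
  integerRightOptions-≥G (All.map flex≤0⇒integer optionsFlex≤0) ldH runs
mainTheorem10 _ _ _ _ (_ , flex-max {m = suc _} _ _ _ , s≤s ()) _
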